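{- Let $\mathfrak{T}=(T;<)$ be a tree and $S$ a stem of $\mathfrak{T}$. Then $S$ is branching$_2$ if and only if every bar over $S$ has at least two elements.
   Context: A forest is a strict partial order $(F;<)$ such that for every $x$ the set $\{y:y<x\}$ is linearly ordered; a tree is a forest that is downward-connected: for all $x,y$ there is $z$ with $z\leqslant x$ and $z\leqslant y$. Trees are not assumed well-founded or rooted. A path is a maximal linearly ordered set of nodes. A stem is a nonempty linearly ordered set of nodes that is downward-closed and bounded above. For a stem $S$ let $T^{>S}=\{x:s<x\text{ for all }s\in S\}$. $S$ is branching$_2$ if every node of $T^{>S}$ is incomparable with some node of $T^{>S}$. A bar over $S$ is a set $X\subseteq T^{>S}$ such that $X\cap A\neq\emptyset$ for every path $A$ containing $S$. -}

module Defs where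

open import Level using (0ℓ)
open import Data.Product using (Σ; ∃; ∃-syntax; _×_; _,_)
open import Data.Sum using (_⊎_)
open import Relation.Nullary using (¬_)
open import Relation.Unary using (Pred; _⊆_)
open import Relation.Binary.PropositionalEquality using (_≡_; _≢_)

-- A tree (T ; <): a strict partial order in which the set of predecessors
-- of every node is linearly ordered, and which is downward-connected.
-- Not assumed well-founded or rooted.
record Tree : Set₁ where
  field
    Carrier : Set
    _<_     : Carrier → Carrier → Set

  _≤_ : Carrier → Carrier → Set
  x ≤ y = x < y ⊎ x ≡ y

  Comparable : Carrier → Carrier → Set
  Comparable x y = x ≤ y ⊎ y ≤ x

  Incomparable : Carrier → Carrier → Set
  Incomparable x y = ¬ Comparable x y

  field
    <-irrefl  : ∀ x → ¬ (x < x)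
    <-trans   : ∀ {x y z} → x < y → y < z → x < z
    pred-linear : ∀ {x y z} → y < x → z < x → Comparable y z
    connected : ∀ x y → ∃[ z ] (z ≤ x × z ≤ y)

module TreeNotions (𝒯 : Tree) where
  open Tree 𝒯

  NodeSet : Set₁
  NodeSet = Pred Carrier 0ℓ

  Linear : NodeSet → Set
  Linear A = ∀ {x y} → A x → A y → Comparable x y

  IsPath : NodeSet → Set₁
  IsPath A = Linear A × (∀ (B : NodeSet) → Linear B → A ⊆ B → B ⊆ A)

  IsStem : NodeSet → Set
  IsStem S = (∃[ s ] S s)
           × Linear S
           × (∀ {x y} → S x → y < x → S y)
           × (∃[ b ] (∀ {s} → S s → s ≤ b))

  Above : NodeSet → NodeSet
  Above S x = ∀ {s} → S s → s < x

  Branching₂ : NodeSet → Set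
  Branching₂ S = ∀ x → Above S x → ∃[ y ] (Above S y × Incomparable x y)

  IsBar : NodeSet → NodeSet → Set₁
  IsBar S X = (X ⊆ Above S)
            × (∀ (A : NodeSet) → IsPath A → S ⊆ A → ∃[ x ] (X x × A x))

  AtLeastTwo : NodeSet → Set
  AtLeastTwo X = ∃[ x ] ∃[ y ] (X x × X y × x ≢ y)

  HausdorffMaximality : Set₁
  HausdorffMaximality = ∀ (C : NodeSet) → Linear C → Σ NodeSet (λ A → IsPath A × C ⊆ A)

{-# OPTIONS --safe #-}
-- If S is branching₂, a bar meets some
-- path A through S at x; a node y above S incomparable with x lies on another
-- path B through S, and the point where the bar meets B differs from x since
-- x and y are incomparable.  Conversely, if some x above S is comparable with
-- every node above S, then x is comparable with every node of any path through
-- S, so lies on it by maximality: ｛ x ｝ is a one-element bar.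
module Submission where

open import Defs
open import Level using (0ℓ; suc; lift; lower)
open import Axiom.ExcludedMiddle using (ExcludedMiddle)
open import Function.Bundles using (_⇔_; mk⇔)
open import Data.Product using (∃-syntax; _×_; _,_; proj₁)
open import Data.Sum using (inj₁; inj₂)
open import Data.Empty using (⊥-elim)
open import Relation.Nullary using (¬_; yes; no)
open import Relation.Nullary.Decidable using (map′)
open import Relation.Binary.PropositionalEquality using (refl)
open import Relation.Unary using (_⊆_; _∪_; ｛_｝)

lower-em : ExcludedMiddle (suc 0ℓ) → ExcludedMiddle 0ℓ
lower-em em = map′ lower lift em

module TreeLemmas (𝒯 : Tree) where
  open Tree 𝒯
  open TreeNotions 𝒯

  DownwardClosed : NodeSet → Set
  DownwardClosed S = ∀ {x y} → S x → y < x → S y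

  Comparable-refl : ∀ x → Comparable x x
  Comparable-refl x = inj₁ (inj₂ refl)

  Comparable-sym : ∀ {x y} → Comparable x y → Comparable y x
  Comparable-sym (inj₁ x≤y) = inj₂ x≤y
  Comparable-sym (inj₂ y≤x) = inj₁ y≤x

  Linear-∪-｛｝ : ∀ {A x} → Linear A → (∀ {a} → A a → Comparable a x) → Linear (A ∪ ｛ x ｝)
  Linear-∪-｛｝ linA compX (inj₁ Aa) (inj₁ Ab)     = linA Aa Ab
  Linear-∪-｛｝ linA compX (inj₁ Aa) (inj₂ refl)   = compX Aa
  Linear-∪-｛｝ linA compX (inj₂ refl) (inj₁ Ab)   = Comparable-sym (compX Ab)
  Linear-∪-｛｝ linA compX (inj₂ refl) (inj₂ refl) = Comparable-refl _

  Linear-∪-｛Above｝ : ∀ {S y} → Linear S → Above S y → Linear (S ∪ ｛ y ｝)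
  Linear-∪-｛Above｝ linS S<y = Linear-∪-｛｝ linS (λ Ss → inj₁ (inj₁ (S<y Ss)))

  path-maximal : ∀ {A x} → IsPath A → (∀ {a} → A a → Comparable a x) → A x
  path-maximal (linA , maxA) compX =
    maxA _ (Linear-∪-｛｝ linA compX) inj₁ (inj₂ refl)

  Above-of-∉ : ∀ {S A a} → DownwardClosed S → Linear A → S ⊆ A →
               A a → ¬ S a → Above S a
  Above-of-∉ downS linA S⊆A Aa a∉S Ss with linA (S⊆A Ss) Aa
  ... | inj₁ (inj₁ s<a)  = s<a
  ... | inj₁ (inj₂ refl) = ⊥-elim (a∉S Ss)
  ... | inj₂ (inj₁ a<s)  = ⊥-elim (a∉S (downS Ss a<s))
  ... | inj₂ (inj₂ refl) = ⊥-elim (a∉S Ss)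

  ¬AtLeastTwo-｛｝ : ∀ x → ¬ AtLeastTwo ｛ x ｝
  ¬AtLeastTwo-｛｝ x (_ , _ , refl , refl , x≢x) = x≢x refl

  Branching₂⇒bars-AtLeastTwo : HausdorffMaximality → ∀ {S} → Linear S → Branching₂ S →
                                 ∀ X → IsBar S X → AtLeastTwo X
  Branching₂⇒bars-AtLeastTwo hm {S} linS branching X (X⊆Above , meets)
    with hm S linS
  ... | A , pathA , S⊆A
    with meets A pathA S⊆A
  ... | x , Xx , _
    with branching x (X⊆Above Xx)
  ... | y , S<y , x⋈̸y
    with hm (S ∪ ｛ y ｝) (Linear-∪-｛Above｝ linS S<y)
  ... | B , pathB , Sy⊆B
    with meets B pathB (λ Ss → Sy⊆B (inj₁ Ss))
  ... | x′ , Xx′ , Bx′ =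
    x , x′ , Xx , Xx′ , λ { refl → x⋈̸y (proj₁ pathB Bx′ (Sy⊆B (inj₂ refl))) }

  ｛｝-IsBar : ExcludedMiddle 0ℓ → ∀ {S x} → DownwardClosed S → Above S x →
              (∀ {y} → Above S y → Comparable x y) → IsBar S ｛ x ｝
  ｛｝-IsBar em {S} {x} downS S<x compX =
    (λ { refl → S<x }) , λ A pathA S⊆A → x , refl , path-maximal pathA (comparable-on A pathA S⊆A)
    where
    comparable-on : ∀ A → IsPath A → S ⊆ A → ∀ {a} → A a → Comparable a x
    comparable-on A (linA , _) S⊆A {a} Aa with em {S a}
    ... | yes Sa = inj₁ (inj₁ (S<x Sa))
    ... | no a∉S = Comparable-sym (compX (Above-of-∉ downS linA S⊆A Aa a∉S))

  bars-AtLeastTwo⇒Branching₂ : ExcludedMiddle 0ℓ → ∀ {S} → DownwardClosed S →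
                                 (∀ X → IsBar S X → AtLeastTwo X) → Branching₂ S
  bars-AtLeastTwo⇒Branching₂ em {S} downS bars-large x S<x
    with em {∃[ y ] (Above S y × Incomparable x y)}
  ... | yes witness = witness
  ... | no none =
    ⊥-elim (¬AtLeastTwo-｛｝ x (bars-large ｛ x ｝ (｛｝-IsBar em downS S<x compX)))
    where
    compX : ∀ {y} → Above S y → Comparable x y
    compX {y} S<y with em {Comparable x y}
    ... | yes x⋈y = x⋈y
    ... | no x⋈̸y = ⊥-elim (none (y , S<y , x⋈̸y))

proposition3p9 : ExcludedMiddle (suc 0ℓ) → (𝒯 : Tree) → TreeNotions.HausdorffMaximality 𝒯 →
    (S : TreeNotions.NodeSet 𝒯) → TreeNotions.IsStem 𝒯 S →
    TreeNotions.Branching₂ 𝒯 S ⇔ (∀ (X : TreeNotions.NodeSet 𝒯) → TreeNotions.IsBar 𝒯 S X → TreeNotions.AtLeastTwo 𝒯 X)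
proposition3p9 em 𝒯 hm S (_ , linS , downS , _) =
  mk⇔ (Branching₂⇒bars-AtLeastTwo hm linS)
      (bars-AtLeastTwo⇒Branching₂ (lower-em em) downS)
  where open TreeLemmas 𝒯
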